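{- Let $h\ge2$ be an integer, let $a/b$ be an $h$-Farey fraction with predecessor $a'/b'$, and let $\ell\ge3$ be an integer. Define $\phi'_i=\{ia'/b'\}$ for $1\le i\le h$, $s_i=\left(\!\binom{\ell-1}{i}\!\right)$ for $i\ge0$, $s=\left(\!\binom{\ell}{h}\!\right)$ and $E_0=-\ell\sum_{i=0}^{h-1}\phi'_{h-i}s_i+\phi'_h s$. If $b'\ne1$, then $E_0<0$.
   Context: An $h$-Farey fraction is a reduced fraction $a/b$ with $a\in\mathbb Z$ and $1\le b\le h$; its predecessor $a'/b'$ is the largest $h$-Farey fraction strictly less than $a/b$, written in lowest terms with $1\le b'\le h$ (one has $ab'-a'b=1$). $\{x\}=x-\lfloor x\rfloor$ denotes the fractional part, and $\left(\!\binom{n}{i}\!\right)=\binom{n+i-1}{i}$. -}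

module Defs where

open import Data.Nat as ℕ using (ℕ; zero; suc; _∸_)
open import Data.Nat.Coprimality using (Coprime)
open import Data.Nat.Combinatorics using (_C_)
open import Data.Integer as ℤ using (ℤ; +_; ∣_∣)
open import Data.Rational as ℚ using (ℚ; 0ℚ; floor; _/_; _<_; _≤_; _+_; _*_; -_; _-_)
open import Data.List using (List; map; foldr; upTo)
open import Data.Product using (_×_)

-- the rational a/b for a denominator b ≥ 1 (value at b = 0 is a dummy, never used)
_÷_ : ℤ → ℕ → ℚ
a ÷ zero = 0ℚ
a ÷ suc n = a / suc n

frac : ℚ → ℚ
frac x = x - (floor x / 1)

HFarey : ℕ → ℤ → ℕ → Set
HFarey h a b = (1 ℕ.≤ b) × (b ℕ.≤ h) × Coprime ∣ a ∣ b

IsPredecessor : ℕ → ℤ → ℕ → ℤ → ℕ → Set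
IsPredecessor h a b a' b' =
  HFarey h a' b' × (a' ÷ b' < a ÷ b) ×
  (∀ (c : ℤ) (d : ℕ) → HFarey h c d → c ÷ d < a ÷ b → c ÷ d ≤ a' ÷ b')

multichoose : ℕ → ℕ → ℕ
multichoose n i = (n ℕ.+ i ∸ 1) C i

sumℚ : List ℚ → ℚ
sumℚ = foldr _+_ 0ℚ

φ' : ℤ → ℕ → ℕ → ℚ
φ' a' b' i = frac ((+ i ℤ.* a') ÷ b')

E₀ : ℕ → ℕ → ℤ → ℕ → ℚ
E₀ h ℓ a' b' =
  (- ((+ ℓ) / 1)) * sumℚ (map (λ i → φ' a' b' (h ∸ i) * ((+ multichoose (ℓ ∸ 1) i) / 1)) (upTo h))
  + φ' a' b' h * ((+ multichoose ℓ h) / 1)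

-- Write d = b' and α = a' mod d, so that φ'_k = ρ(k)/d with ρ(k) = kα mod d. Then
-- d·E₀ = ρ(h)·((ℓ h)) − ℓ·Σ_{i<h} ((ℓ-1 i))·ρ(h−i), and only three properties of ρ matter:
-- ρ(0) = 0, ρ is subadditive, and ρ(h) < h·ρ(1), since ρ(h) < d ≤ h and ρ(1) = α ≠ 0 (a' is
-- coprime to d > 1). As ℓ·Σ_{i<h} ((ℓ-1 i))·(h−i) = h·((ℓ h)), the claim becomes
-- Σ_{i<h} w_i (h−i) ρ(h) < Σ_{i<h} w_i h ρ(h−i) for the weights w_i = ((ℓ-1 i)), strictly increasing
-- as ℓ - 1 ≥ 2. By Abel summation it suffices that every tail sum on the left is at most the one
-- on the right, and that the last one, ρ(h) < h·ρ(1), is strict. For the tail of length m this is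
-- m(m+1)/2·ρ(h) ≤ h·(ρ(1) + … + ρ(m)), which holds for every subadditive ρ with ρ(0) = 0 and
-- m ≤ h: bound windows of the prefix sum by pairing ρ(j) + ρ(c − j) ≥ ρ(c), and descend on (m, h)
-- as in Euclid's algorithm.
module Submission where

open import Function using (_∘_)
open import Data.Nat
open import Data.Nat.Properties
open import Data.Nat.Combinatorics using (_C_; nCk+nC[k+1]≡[n+1]C[k+1])
open import Data.Nat.Combinatorics.Specification using (k>n⇒nCk≡0)
open import Data.Nat.Coprimality using (Coprime)
open import Data.Nat.DivMod using (m≡m%n+[m/n]*n; m%n≤m; m%n<n; m<n⇒m%n≡m; %-distribˡ-+)
open import Data.Nat.Divisibility using (divides; ∣-refl)
open import Data.Nat.Tactic.RingSolver using (solve-∀)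
open import Algebra.Properties.CommutativeSemigroup +-commutativeSemigroup using (interchange)
open import Data.Integer as ℤ using (ℤ; +_; +[1+_]; -[1+_]; ∣_∣)
import Data.Integer.Properties as ℤ
open import Data.Integer.DivMod using (a≡a%n+[a/n]*n; n%d<d)
import Data.Integer.Tactic.RingSolver as ℤ-Solver
open import Data.Rational as ℚ using (ℚ; mkℚ; 0ℚ; floor; toℚᵘ)
import Data.Rational.Properties as ℚ
open import Data.Rational.Unnormalised as ℚᵘ using (mkℚᵘ; *≡*; *<*)
import Data.Rational.Unnormalised.Properties as ℚᵘ
open import Data.List using (map; applyUpTo; upTo)
open import Data.Product using (_,_)
open import Data.Empty using (⊥-elim)
open import Relation.Nullary using (¬_; yes; no)
open import Relation.Binary.PropositionalEquality
open import Defs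

∑ : ℕ → (ℕ → ℕ) → ℕ
∑ zero    f = 0
∑ (suc n) f = f 0 + ∑ n (f ∘ suc)

syntax ∑ n (λ i → e) = ∑[ i < n ] e

∑-cong : ∀ n {f g : ℕ → ℕ} → (∀ {i} → i < n → f i ≡ g i) → ∑ n f ≡ ∑ n g
∑-cong zero    eq = refl
∑-cong (suc n) eq = cong₂ _+_ (eq z<s) (∑-cong n (eq ∘ s<s))

∑-mono-≤ : ∀ n {f g : ℕ → ℕ} → (∀ {i} → i < n → f i ≤ g i) → ∑ n f ≤ ∑ n g
∑-mono-≤ zero    le = z≤n
∑-mono-≤ (suc n) le = +-mono-≤ (le z<s) (∑-mono-≤ n (le ∘ s<s))

∑-const : ∀ n c → ∑[ i < n ] c ≡ n * c
∑-const zero    c = refl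
∑-const (suc n) c = cong (_+_ c) (∑-const n c)

∑-distrib-+ : ∀ n (f g : ℕ → ℕ) → ∑[ i < n ] (f i + g i) ≡ ∑ n f + ∑ n g
∑-distrib-+ zero    f g = refl
∑-distrib-+ (suc n) f g = begin
  f 0 + g 0 + ∑[ i < n ] (f (suc i) + g (suc i))
    ≡⟨ cong (_+_ (f 0 + g 0)) (∑-distrib-+ n (f ∘ suc) (g ∘ suc)) ⟩
  f 0 + g 0 + (∑ n (f ∘ suc) + ∑ n (g ∘ suc))
    ≡⟨ interchange (f 0) (g 0) _ _ ⟩
  f 0 + ∑ n (f ∘ suc) + (g 0 + ∑ n (g ∘ suc))
    ∎
  where open ≡-Reasoning

∑-distribˡ-* : ∀ n c (f : ℕ → ℕ) → ∑[ i < n ] (c * f i) ≡ c * ∑ n f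
∑-distribˡ-* zero    c f = sym (*-zeroʳ c)
∑-distribˡ-* (suc n) c f =
  trans (cong (_+_ (c * f 0)) (∑-distribˡ-* n c (f ∘ suc))) (sym (*-distribˡ-+ c (f 0) _))

∑-distribʳ-* : ∀ n c (f : ℕ → ℕ) → ∑[ i < n ] (f i * c) ≡ ∑ n f * c
∑-distribʳ-* n c f = begin
  ∑[ i < n ] (f i * c) ≡⟨ ∑-cong n (λ {i} _ → *-comm (f i) c) ⟩
  ∑[ i < n ] (c * f i) ≡⟨ ∑-distribˡ-* n c f ⟩
  c * ∑ n f            ≡⟨ *-comm c _ ⟩
  ∑ n f * c            ∎
  where open ≡-Reasoning

∑-+ : ∀ m n (f : ℕ → ℕ) → ∑ (m + n) f ≡ ∑ m f + ∑[ i < n ] f (m + i)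
∑-+ zero    n f = refl
∑-+ (suc m) n f = trans (cong (_+_ (f 0)) (∑-+ m n (f ∘ suc))) (sym (+-assoc (f 0) _ _))

∑-last : ∀ n (f : ℕ → ℕ) → ∑ (suc n) f ≡ ∑ n f + f n
∑-last n f = begin
  ∑ (suc n) f             ≡⟨ cong (λ k → ∑ k f) (+-comm 1 n) ⟩
  ∑ (n + 1) f             ≡⟨ ∑-+ n 1 f ⟩
  ∑ n f + (f (n + 0) + 0) ≡⟨ cong (_+_ (∑ n f)) (trans (+-identityʳ _) (cong f (+-identityʳ n))) ⟩
  ∑ n f + f n             ∎
  where open ≡-Reasoning

∑-reverse : ∀ n (f : ℕ → ℕ) → ∑[ i < n ] f (n ∸ suc i) ≡ ∑ n f
∑-reverse zero    f = refl
∑-reverse (suc n) f = begin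
  f n + ∑[ i < n ] f (n ∸ suc i) ≡⟨ cong (_+_ (f n)) (∑-reverse n f) ⟩
  f n + ∑ n f                    ≡⟨ +-comm (f n) _ ⟩
  ∑ n f + f n                    ≡⟨ ∑-last n f ⟨
  ∑ (suc n) f                    ∎
  where open ≡-Reasoning

∑-split-weight : ∀ n c (v x : ℕ → ℕ) → (∀ i → c ≤ v i) →
                 ∑[ i < n ] (v i * x i) ≡ c * ∑ n x + ∑[ i < n ] ((v i ∸ c) * x i)
∑-split-weight n c v x c≤v = begin
  ∑[ i < n ] (v i * x i)                 ≡⟨ ∑-cong n (λ {i} _ → cong (_* x i) (m+[n∸m]≡n (c≤v i))) ⟨
  ∑[ i < n ] ((c + (v i ∸ c)) * x i)     ≡⟨ ∑-cong n (λ {i} _ → *-distribʳ-+ (x i) c (v i ∸ c)) ⟩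
  ∑[ i < n ] (c * x i + (v i ∸ c) * x i) ≡⟨ ∑-distrib-+ n (λ i → c * x i) (λ i → (v i ∸ c) * x i) ⟩
  ∑[ i < n ] (c * x i) + rest            ≡⟨ cong (_+ rest) (∑-distribˡ-* n c x) ⟩
  c * ∑ n x + rest                       ∎
  where
  open ≡-Reasoning
  rest = ∑[ i < n ] ((v i ∸ c) * x i)

∑-peel-weight : ∀ n (w x : ℕ → ℕ) → (∀ i → w 0 ≤ w (suc i)) →
                ∑[ i < suc n ] (w i * x i) ≡
                w 0 * ∑ (suc n) x + ∑[ i < n ] ((w (suc i) ∸ w 0) * x (suc i))
∑-peel-weight n w x w₀≤w = begin
  w 0 * x 0 + ∑[ i < n ] (w (suc i) * x (suc i))
    ≡⟨ cong (_+_ (w 0 * x 0)) (∑-split-weight n (w 0) (w ∘ suc) (x ∘ suc) w₀≤w) ⟩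
  w 0 * x 0 + (w 0 * ∑ n (x ∘ suc) + rest)
    ≡⟨ +-assoc (w 0 * x 0) (w 0 * ∑ n (x ∘ suc)) rest ⟨
  w 0 * x 0 + w 0 * ∑ n (x ∘ suc) + rest
    ≡⟨ cong (_+ rest) (*-distribˡ-+ (w 0) (x 0) (∑ n (x ∘ suc))) ⟨
  w 0 * ∑ (suc n) x + rest
    ∎
  where
  open ≡-Reasoning
  rest = ∑[ i < n ] ((w (suc i) ∸ w 0) * x (suc i))

-- Abel summation: the difference of the two sides combines the tail differences with the
-- positive coefficients w 0, w 1 - w 0, w 2 - w 1, …, and the last tail difference is positive.
abel-< : ∀ n (w a b : ℕ → ℕ) → 0 < w 0 → (∀ i → w i < w (suc i)) →
         (∀ t → ∑[ i < suc n ∸ t ] b (t + i) ≤ ∑[ i < suc n ∸ t ] a (t + i)) → b n < a n →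
         ∑[ i < suc n ] (w i * b i) < ∑[ i < suc n ] (w i * a i)
abel-< zero    w a b w₀>0 w-inc tails bₙ<aₙ = +-monoˡ-< 0 (*-monoʳ-< (w 0) {{>-nonZero w₀>0}} bₙ<aₙ)
abel-< (suc n) w a b w₀>0 w-inc tails bₙ<aₙ = begin-strict
  ∑[ i < suc (suc n) ] (w i * b i)
    ≡⟨ ∑-peel-weight (suc n) w b w₀≤w ⟩
  w 0 * ∑ (suc (suc n)) b + ∑[ i < suc n ] (w′ i * b (suc i))
    <⟨ +-mono-≤-< (*-monoʳ-≤ (w 0) (tails 0))
                  (abel-< n w′ (a ∘ suc) (b ∘ suc) (m<n⇒0<n∸m (w-inc 0)) w′-inc (tails ∘ suc) bₙ<aₙ) ⟩
  w 0 * ∑ (suc (suc n)) a + ∑[ i < suc n ] (w′ i * a (suc i))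
    ≡⟨ ∑-peel-weight (suc n) w a w₀≤w ⟨
  ∑[ i < suc (suc n) ] (w i * a i)
    ∎
  where
  open ≤-Reasoning
  w′ : ℕ → ℕ
  w′ i = w (suc i) ∸ w 0
  w₀≤w : ∀ i → w 0 ≤ w (suc i)
  w₀≤w zero    = <⇒≤ (w-inc 0)
  w₀≤w (suc i) = ≤-trans (w₀≤w i) (<⇒≤ (w-inc (suc i)))
  w′-inc : ∀ i → w′ i < w′ (suc i)
  w′-inc i = ∸-monoˡ-< (w-inc (suc i)) (w₀≤w i)

∑-triangular : ∀ m → 2 * ∑[ i < m ] (m ∸ i) ≡ m * suc m
∑-triangular zero    = refl
∑-triangular (suc m) = begin
  2 * (suc m + ∑[ i < m ] (m ∸ i))   ≡⟨ *-distribˡ-+ 2 (suc m) _ ⟩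
  2 * suc m + 2 * ∑[ i < m ] (m ∸ i) ≡⟨ cong (_+_ (2 * suc m)) (∑-triangular m) ⟩
  2 * suc m + m * suc m              ≡⟨ *-distribʳ-+ (suc m) 2 m ⟨
  suc (suc m) * suc m                ≡⟨ *-comm (suc (suc m)) (suc m) ⟩
  suc m * suc (suc m)                ∎
  where open ≡-Reasoning

module Subadditive (y : ℕ → ℕ) (y₀ : y 0 ≡ 0) (y-subadd : ∀ i j → y (i + j) ≤ y i + y j) where

  pairing-bound : ∀ k e → suc e * y (k + k + e) ≤ 2 * ∑[ i < suc e ] y (k + i)
  pairing-bound k e = begin
    suc e * y (k + k + e)                        ≡⟨ ∑-const (suc e) _ ⟨
    ∑[ i < suc e ] y (k + k + e)                 ≤⟨ ∑-mono-≤ (suc e) pair ⟩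
    ∑[ i < suc e ] (y (k + i) + y (k + (e ∸ i))) ≡⟨ ∑-distrib-+ (suc e) (y ∘ _+_ k) (λ i → y (k + (e ∸ i))) ⟩
    window + ∑[ i < suc e ] y (k + (e ∸ i))      ≡⟨ cong (_+_ window) (∑-reverse (suc e) (y ∘ _+_ k)) ⟩
    window + window                              ≡⟨ cong (_+_ window) (+-identityʳ window) ⟨
    2 * window                                   ∎
    where
    open ≤-Reasoning
    window = ∑[ i < suc e ] y (k + i)
    regroup : ∀ k i j → k + k + (i + j) ≡ (k + i) + (k + j)
    regroup = solve-∀
    pair : ∀ {i} → i < suc e → y (k + k + e) ≤ y (k + i) + y (k + (e ∸ i))
    pair {i} i≤e = begin
      y (k + k + e)               ≡⟨ cong (y ∘ (_+_ (k + k))) (m+[n∸m]≡n (s≤s⁻¹ i≤e)) ⟨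
      y (k + k + (i + (e ∸ i)))   ≡⟨ cong y (regroup k i (e ∸ i)) ⟩
      y ((k + i) + (k + (e ∸ i))) ≤⟨ y-subadd (k + i) (k + (e ∸ i)) ⟩
      y (k + i) + y (k + (e ∸ i)) ∎

  private
    T : ℕ → ℕ
    T m = ∑[ i < m ] y (suc i)

  prefix-self-bound : ∀ m → suc m * y m ≤ 2 * ∑[ i < m ] y (suc i)
  prefix-self-bound m = subst (λ y0 → suc m * y m ≤ 2 * (y0 + T m)) y₀ (pairing-bound 0 m)

  private
    prefix-bound-split : ∀ m k → m * suc m * y k ≤ 2 * k * T m →
                         m * suc m * y (m + k) ≤ 2 * (m + k) * T m
    prefix-bound-split m k IH = begin
      m * suc m * y (m + k)               ≤⟨ *-monoʳ-≤ (m * suc m) (y-subadd m k) ⟩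
      m * suc m * (y m + y k)             ≡⟨ expand m (y m) (y k) ⟩
      m * (suc m * y m) + m * suc m * y k ≤⟨ +-mono-≤ (*-monoʳ-≤ m (prefix-self-bound m)) IH ⟩
      m * (2 * T m) + 2 * k * T m         ≡⟨ collect m k (T m) ⟩
      2 * (m + k) * T m                   ∎
      where
      open ≤-Reasoning
      expand : ∀ m a b → m * suc m * (a + b) ≡ m * (suc m * a) + m * suc m * b
      expand = solve-∀
      collect : ∀ m k t → m * (2 * t) + 2 * k * t ≡ 2 * (m + k) * t
      collect = solve-∀

    prefix-bound-fold : ∀ d e → let m = suc (d + e); h = m + suc d in
                        d * suc d * y h ≤ 2 * h * T d → m * suc m * y h ≤ 2 * h * T m
    prefix-bound-fold d e IH = begin
      m * suc m * y h
        ≡⟨ expand d e (y h) ⟩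
      h * (suc e * y h) + d * suc d * y h
        ≡⟨ cong (λ i → h * (suc e * y i) + d * suc d * y h) (reindex d e) ⟩
      h * (suc e * y (suc d + suc d + e)) + d * suc d * y h
        ≤⟨ +-mono-≤ (*-monoʳ-≤ h (pairing-bound (suc d) e)) IH ⟩
      h * (2 * window) + 2 * h * T d
        ≡⟨ collect h window (T d) ⟩
      2 * h * (T d + window)
        ≡⟨ cong (2 * h *_) (∑-+ d (suc e) (y ∘ suc)) ⟨
      2 * h * ∑ (d + suc e) (y ∘ suc)
        ≡⟨ cong (λ n → 2 * h * ∑ n (y ∘ suc)) (+-suc d e) ⟩
      2 * h * T m
        ∎
      where
      open ≤-Reasoning
      m = suc (d + e)
      h = m + suc d
      window = ∑[ i < suc e ] y (suc d + i)
      expand : ∀ d e z → let m = suc (d + e); h = m + suc d in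
               m * suc m * z ≡ h * (suc e * z) + d * suc d * z
      expand = solve-∀
      reindex : ∀ d e → suc (d + e) + suc d ≡ suc d + suc d + e
      reindex = solve-∀
      collect : ∀ h w t → h * (2 * w) + 2 * h * t ≡ 2 * h * (t + w)
      collect = solve-∀

  -- Descent on m + h: if h = m + k with m ≤ k, recurse on (m, k); otherwise h = m + d + 1 with
  -- d < m, and recurse on (d, h).
  prefix-bound : ∀ {m h} → m ≤ h → m * suc m * y h ≤ 2 * h * ∑[ i < m ] y (suc i)
  prefix-bound = go ≤-refl
    where
    vanish : ∀ c → c * y 0 ≤ 0
    vanish c = ≤-reflexive (trans (cong (c *_) y₀) (*-zeroʳ c))
    go : ∀ {fuel m h} → m + h < fuel → m ≤ h → m * suc m * y h ≤ 2 * h * T m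
    go {m = zero} _ _ = z≤n
    go {suc fuel} {suc m} (s≤s m+h≤fuel) m≤h with m≤n⇒∃[o]m+o≡n m≤h
    ... | zero  , refl = prefix-bound-split (suc m) 0 (vanish (suc m * suc (suc m)))
    ... | suc k , refl with suc m ≤? suc k
    ...   | yes m≤k = prefix-bound-split (suc m) (suc k) (go (≤-trans (s≤s (m≤n+m _ m)) m+h≤fuel) m≤k)
    ...   | no  m≰k with m≤n⇒∃[o]m+o≡n (<⇒≤ (s≤s⁻¹ (≰⇒> m≰k)))
    ...     | e , refl = prefix-bound-fold k e (go (<-≤-trans (+-monoˡ-< _ (s≤s (m≤m+n k e))) m+h≤fuel)
                                                   (≤-trans (n≤1+n k) (m≤n+m (suc k) (suc (k + e)))))

  tail-bound : ∀ {m h} → m ≤ h → ∑[ i < m ] ((m ∸ i) * y h) ≤ ∑[ i < m ] (h * y (m ∸ i))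
  tail-bound {m} {h} m≤h = *-cancelˡ-≤ 2 (begin
    2 * ∑[ i < m ] ((m ∸ i) * y h)           ≡⟨ cong (2 *_) (∑-distribʳ-* m (y h) (m ∸_)) ⟩
    2 * (∑[ i < m ] (m ∸ i) * y h)           ≡⟨ *-assoc 2 (∑[ i < m ] (m ∸ i)) (y h) ⟨
    2 * ∑[ i < m ] (m ∸ i) * y h             ≡⟨ cong (_* y h) (∑-triangular m) ⟩
    m * suc m * y h                          ≤⟨ prefix-bound m≤h ⟩
    2 * h * T m                              ≡⟨ *-assoc 2 h (T m) ⟩
    2 * (h * T m)                            ≡⟨ cong (λ s → 2 * (h * s)) (∑-reverse m (y ∘ suc)) ⟨
    2 * (h * ∑[ i < m ] y (suc (m ∸ suc i)))
      ≡⟨ cong (λ s → 2 * (h * s)) (∑-cong m (λ i<m → cong y (+-∸-assoc 1 i<m))) ⟨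
    2 * (h * ∑[ i < m ] y (m ∸ i))           ≡⟨ cong (2 *_) (∑-distribˡ-* m h (λ i → y (m ∸ i))) ⟨
    2 * ∑[ i < m ] (h * y (m ∸ i))           ∎)
    where open ≤-Reasoning

private
  multichoose′ : ℕ → ℕ → ℕ
  multichoose′ n       zero    = 1
  multichoose′ zero    (suc i) = 0
  multichoose′ (suc n) (suc i) = multichoose′ n (suc i) + multichoose′ (suc n) i

  multichoose≡multichoose′ : ∀ n i → multichoose n i ≡ multichoose′ n i
  multichoose≡multichoose′ n       zero    = refl
  multichoose≡multichoose′ zero    (suc i) = k>n⇒nCk≡0 (n<1+n i)
  multichoose≡multichoose′ (suc n) (suc i) = begin
    (n + suc i) C suc i                           ≡⟨ cong (_C suc i) (+-suc n i) ⟩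
    suc (n + i) C suc i                           ≡⟨ nCk+nC[k+1]≡[n+1]C[k+1] (n + i) i ⟨
    multichoose (suc n) i + (n + i) C suc i       ≡⟨ cong (λ k → multichoose (suc n) i + (k ∸ 1) C suc i) (+-suc n i) ⟨
    multichoose (suc n) i + multichoose n (suc i) ≡⟨ +-comm (multichoose (suc n) i) _ ⟩
    multichoose n (suc i) + multichoose (suc n) i
      ≡⟨ cong₂ _+_ (multichoose≡multichoose′ n (suc i)) (multichoose≡multichoose′ (suc n) i) ⟩
    multichoose′ n (suc i) + multichoose′ (suc n) i ∎
    where open ≡-Reasoning

  multichoose′-pos : ∀ n i → 0 < multichoose′ (suc n) i
  multichoose′-pos n zero    = z<s
  multichoose′-pos n (suc i) = <-≤-trans (multichoose′-pos n i) (m≤n+m _ (multichoose′ n (suc i)))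

  ∑-multichoose′ : ∀ n h → ∑[ i < suc h ] multichoose′ n i ≡ multichoose′ (suc n) h
  ∑-multichoose′ n zero    = refl
  ∑-multichoose′ n (suc h) = begin
    ∑[ i < suc (suc h) ] multichoose′ n i                    ≡⟨ ∑-last (suc h) (multichoose′ n) ⟩
    ∑[ i < suc h ] multichoose′ n i + multichoose′ n (suc h)
      ≡⟨ cong (_+ multichoose′ n (suc h)) (∑-multichoose′ n h) ⟩
    multichoose′ (suc n) h + multichoose′ n (suc h)          ≡⟨ +-comm (multichoose′ (suc n) h) _ ⟩
    multichoose′ (suc n) (suc h)                             ∎
    where open ≡-Reasoning

  suc-*-multichoose′ : ∀ n i → suc i * multichoose′ n (suc i) ≡ (n + i) * multichoose′ n i
  suc-*-multichoose′ zero    zero    = refl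
  suc-*-multichoose′ zero    (suc i) = trans (*-zeroʳ (suc (suc i))) (sym (*-zeroʳ (suc i)))
  suc-*-multichoose′ (suc n) zero    = begin
    1 * (multichoose′ n 1 + 1) ≡⟨ *-distribˡ-+ 1 (multichoose′ n 1) 1 ⟩
    1 * multichoose′ n 1 + 1   ≡⟨ cong (_+ 1) (suc-*-multichoose′ n 0) ⟩
    (n + 0) * 1 + 1            ≡⟨ rearrange n ⟩
    (suc n + 0) * 1            ∎
    where
    open ≡-Reasoning
    rearrange : ∀ n → (n + 0) * 1 + 1 ≡ (suc n + 0) * 1
    rearrange = solve-∀
  suc-*-multichoose′ (suc n) (suc i) = begin
    suc (suc i) * (a + y)                       ≡⟨ *-distribˡ-+ (suc (suc i)) a y ⟩
    suc (suc i) * a + (y + suc i * y)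
      ≡⟨ cong₂ (λ p q → p + (y + q)) (suc-*-multichoose′ n (suc i)) (suc-*-multichoose′ (suc n) i) ⟩
    (n + suc i) * x + (x + z + (suc n + i) * z) ≡⟨ rearrange n i x z ⟩
    (suc n + suc i) * (x + z)                   ∎
    where
    open ≡-Reasoning
    a = multichoose′ n (suc (suc i))
    x = multichoose′ n (suc i)
    z = multichoose′ (suc n) i
    y = x + z
    rearrange : ∀ n i x z → (n + suc i) * x + (x + z + (suc n + i) * z) ≡ (suc n + suc i) * (x + z)
    rearrange = solve-∀

  ∑-multichoose′-*-∸-suc : ∀ n h → ∑[ i < suc h ] (multichoose′ n i * (suc h ∸ i)) ≡
                           ∑[ i < h ] (multichoose′ n i * (h ∸ i)) + multichoose′ (suc n) h
  ∑-multichoose′-*-∸-suc n h = begin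
    ∑[ i < suc h ] (c i * (suc h ∸ i))
      ≡⟨ ∑-cong (suc h) (λ {i} i≤h → cong (c i *_) (+-∸-assoc 1 (s≤s⁻¹ i≤h))) ⟩
    ∑[ i < suc h ] (c i * suc (h ∸ i))   ≡⟨ ∑-cong (suc h) (λ {i} _ → *-suc (c i) (h ∸ i)) ⟩
    ∑[ i < suc h ] (c i + c i * (h ∸ i)) ≡⟨ ∑-distrib-+ (suc h) c (λ i → c i * (h ∸ i)) ⟩
    ∑ (suc h) c + ∑[ i < suc h ] (c i * (h ∸ i))
      ≡⟨ cong₂ _+_ (∑-multichoose′ n h) (∑-last h (λ i → c i * (h ∸ i))) ⟩
    c′ + (G + c h * (h ∸ h))             ≡⟨ cong (λ k → c′ + (G + c h * k)) (n∸n≡0 h) ⟩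
    c′ + (G + c h * 0)                   ≡⟨ rearrange c′ G (c h) ⟩
    G + c′                               ∎
    where
    open ≡-Reasoning
    c = multichoose′ n
    c′ = multichoose′ (suc n) h
    G = ∑[ i < h ] (c i * (h ∸ i))
    rearrange : ∀ m g c → m + (g + c * 0) ≡ g + m
    rearrange = solve-∀

  ∑-multichoose′-*-∸ : ∀ n h →
                       suc n * ∑[ i < h ] (multichoose′ n i * (h ∸ i)) ≡ h * multichoose′ (suc n) h
  ∑-multichoose′-*-∸ n zero    = *-zeroʳ (suc n)
  ∑-multichoose′-*-∸ n (suc h) = begin
    suc n * ∑[ i < suc h ] (multichoose′ n i * (suc h ∸ i))
      ≡⟨ cong (suc n *_) (∑-multichoose′-*-∸-suc n h) ⟩
    suc n * (G + c)                      ≡⟨ *-distribˡ-+ (suc n) G c ⟩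
    suc n * G + suc n * c                ≡⟨ cong (_+ suc n * c) (∑-multichoose′-*-∸ n h) ⟩
    h * c + suc n * c                    ≡⟨ *-distribʳ-+ c h (suc n) ⟨
    (h + suc n) * c                      ≡⟨ cong (_* c) (+-comm h (suc n)) ⟩
    (suc n + h) * c                      ≡⟨ suc-*-multichoose′ (suc n) h ⟨
    suc h * multichoose′ (suc n) (suc h) ∎
    where
    open ≡-Reasoning
    G = ∑[ i < h ] (multichoose′ n i * (h ∸ i))
    c = multichoose′ (suc n) h

multichoose-increasing : ∀ n i → multichoose (2 + n) i < multichoose (2 + n) (suc i)
multichoose-increasing n i
  rewrite multichoose≡multichoose′ (2 + n) i | multichoose≡multichoose′ (2 + n) (suc i) =
  m<n+m _ (multichoose′-pos n (suc i))

∑-multichoose-*-∸ : ∀ n h → suc n * ∑[ i < h ] (multichoose n i * (h ∸ i)) ≡ h * multichoose (suc n) h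
∑-multichoose-*-∸ n h = begin
  suc n * ∑[ i < h ] (multichoose n i * (h ∸ i))
    ≡⟨ cong (suc n *_) (∑-cong h (λ {i} _ → cong (_* (h ∸ i)) (multichoose≡multichoose′ n i))) ⟩
  suc n * ∑[ i < h ] (multichoose′ n i * (h ∸ i)) ≡⟨ ∑-multichoose′-*-∸ n h ⟩
  h * multichoose′ (suc n) h                      ≡⟨ cong (h *_) (multichoose≡multichoose′ (suc n) h) ⟨
  h * multichoose (suc n) h                       ∎
  where open ≡-Reasoning

module _ (r : ℕ → ℕ) (r₀ : r 0 ≡ 0) (r-subadd : ∀ i j → r (i + j) ≤ r i + r j) where
  open Subadditive r r₀ r-subadd

  subadditive-multichoose-< : ∀ n h → r h < h * r 1 →
    r h * multichoose (3 + n) h < (3 + n) * ∑[ i < h ] (multichoose (2 + n) i * r (h ∸ i))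
  subadditive-multichoose-< n h@(suc k) rₕ<hr₁ = *-cancelˡ-< h _ _ (begin-strict
    h * (r h * multichoose ℓ h) ≡⟨ swap h (r h) _ ⟩
    r h * (h * multichoose ℓ h) ≡⟨ cong (r h *_) (∑-multichoose-*-∸ (2 + n) h) ⟨
    r h * (ℓ * G)               ≡⟨ swap (r h) ℓ G ⟩
    ℓ * (r h * G)               ≡⟨ cong (ℓ *_) weigh-b ⟩
    ℓ * ∑[ i < h ] (w i * b i)  <⟨ *-monoʳ-< ℓ (abel-< k w a b z<s (multichoose-increasing n) tails last) ⟩
    ℓ * ∑[ i < h ] (w i * a i)  ≡⟨ cong (ℓ *_) weigh-a ⟩
    ℓ * (h * A)                 ≡⟨ swap ℓ h A ⟩
    h * (ℓ * A)                 ∎)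
    where
    open ≤-Reasoning
    ℓ = 3 + n
    w = multichoose (2 + n)
    a b : ℕ → ℕ
    a i = h * r (h ∸ i)
    b i = (h ∸ i) * r h
    G = ∑[ i < h ] (w i * (h ∸ i))
    A = ∑[ i < h ] (w i * r (h ∸ i))
    swap : ∀ x y z → x * (y * z) ≡ y * (x * z)
    swap = solve-∀
    rotate : ∀ x y z → x * (y * z) ≡ y * (z * x)
    rotate = solve-∀
    weigh-b : r h * G ≡ ∑[ i < h ] (w i * b i)
    weigh-b = trans (sym (∑-distribˡ-* h (r h) (λ i → w i * (h ∸ i))))
                    (∑-cong h (λ {i} _ → rotate (r h) (w i) (h ∸ i)))
    weigh-a : ∑[ i < h ] (w i * a i) ≡ h * A
    weigh-a = trans (∑-cong h (λ {i} _ → swap (w i) h (r (h ∸ i))))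
                    (∑-distribˡ-* h h (λ i → w i * r (h ∸ i)))
    tails : ∀ t → ∑[ i < h ∸ t ] b (t + i) ≤ ∑[ i < h ∸ t ] a (t + i)
    tails t = begin
      ∑[ i < h ∸ t ] ((h ∸ (t + i)) * r h) ≡⟨ ∑-cong (h ∸ t) (λ {i} _ → cong (_* r h) (∸-+-assoc h t i)) ⟨
      ∑[ i < h ∸ t ] ((h ∸ t ∸ i) * r h)   ≤⟨ tail-bound (m∸n≤m h t) ⟩
      ∑[ i < h ∸ t ] (h * r (h ∸ t ∸ i))   ≡⟨ ∑-cong (h ∸ t) (λ {i} _ → cong ((h *_) ∘ r) (∸-+-assoc h t i)) ⟩
      ∑[ i < h ∸ t ] (h * r (h ∸ (t + i))) ∎
    last : b k < a k
    last = begin-strict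
      (h ∸ k) * r h ≡⟨ cong (_* r h) (m+n∸n≡m 1 k) ⟩
      1 * r h       ≡⟨ *-identityˡ (r h) ⟩
      r h           <⟨ rₕ<hr₁ ⟩
      h * r 1       ≡⟨ cong (λ j → h * r j) (m+n∸n≡m 1 k) ⟨
      h * r (h ∸ k) ∎

toℚᵘ-/ : ∀ z n → toℚᵘ (z ℚ./ suc n) ℚᵘ.≃ mkℚᵘ z n
toℚᵘ-/ z n = ℚ.toℚᵘ-fromℚᵘ (mkℚᵘ z n)

≃ᵘ⇒≡/ : ∀ {p} z n → toℚᵘ p ℚᵘ.≃ mkℚᵘ z n → p ≡ z ℚ./ suc n
≃ᵘ⇒≡/ {p} z n p≃z/n = trans (sym (ℚ.fromℚᵘ-toℚᵘ p)) (ℚ.fromℚᵘ-cong p≃z/n)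

/-distrib-+ : ∀ x y n → (x ℤ.+ y) ℚ./ suc n ≡ x ℚ./ suc n ℚ.+ y ℚ./ suc n
/-distrib-+ x y n = sym (≃ᵘ⇒≡/ (x ℤ.+ y) n (begin
  toℚᵘ (x ℚ./ d ℚ.+ y ℚ./ d)           ≈⟨ ℚ.toℚᵘ-homo-+ (x ℚ./ d) (y ℚ./ d) ⟩
  toℚᵘ (x ℚ./ d) ℚᵘ.+ toℚᵘ (y ℚ./ d)   ≈⟨ ℚᵘ.+-cong (toℚᵘ-/ x n) (toℚᵘ-/ y n) ⟩
  mkℚᵘ x n ℚᵘ.+ mkℚᵘ y n
    ≈⟨ *≡* (trans (distrib x y (+ d)) (cong ((x ℤ.+ y) ℤ.*_) (sym (ℤ.pos-* d d)))) ⟩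
  mkℚᵘ (x ℤ.+ y) n                     ∎))
  where
  open ℚᵘ.≃-Reasoning
  d = suc n
  distrib : ∀ x y d → (x ℤ.* d ℤ.+ y ℤ.* d) ℤ.* d ≡ (x ℤ.+ y) ℤ.* (d ℤ.* d)
  distrib = ℤ-Solver.solve-∀

/-*-/1 : ∀ x y n → (x ℚ./ suc n) ℚ.* (y ℚ./ 1) ≡ (x ℤ.* y) ℚ./ suc n
/-*-/1 x y n = ≃ᵘ⇒≡/ (x ℤ.* y) n (begin
  toℚᵘ (x ℚ./ suc n ℚ.* (y ℚ./ 1))       ≈⟨ ℚ.toℚᵘ-homo-* (x ℚ./ suc n) (y ℚ./ 1) ⟩
  toℚᵘ (x ℚ./ suc n) ℚᵘ.* toℚᵘ (y ℚ./ 1) ≈⟨ ℚᵘ.*-cong (toℚᵘ-/ x n) (toℚᵘ-/ y 0) ⟩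
  mkℚᵘ x n ℚᵘ.* mkℚᵘ y 0
    ≈⟨ *≡* (cong (λ k → (x ℤ.* y) ℤ.* + suc k) (sym (*-identityʳ n))) ⟩
  mkℚᵘ (x ℤ.* y) n                       ∎)
  where open ℚᵘ.≃-Reasoning

-/1-*-/ : ∀ x y n → ℚ.- (x ℚ./ 1) ℚ.* (y ℚ./ suc n) ≡ (ℤ.- (x ℤ.* y)) ℚ./ suc n
-/1-*-/ x y n = ≃ᵘ⇒≡/ (ℤ.- (x ℤ.* y)) n (begin
  toℚᵘ (ℚ.- (x ℚ./ 1) ℚ.* (y ℚ./ suc n))       ≈⟨ ℚ.toℚᵘ-homo-* (ℚ.- (x ℚ./ 1)) (y ℚ./ suc n) ⟩
  toℚᵘ (ℚ.- (x ℚ./ 1)) ℚᵘ.* toℚᵘ (y ℚ./ suc n) ≈⟨ ℚᵘ.*-congʳ (ℚ.toℚᵘ-homo‿- (x ℚ./ 1)) ⟩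
  ℚᵘ.- toℚᵘ (x ℚ./ 1) ℚᵘ.* toℚᵘ (y ℚ./ suc n)
    ≈⟨ ℚᵘ.*-cong (ℚᵘ.-‿cong (toℚᵘ-/ x 0)) (toℚᵘ-/ y n) ⟩
  ℚᵘ.- mkℚᵘ x 0 ℚᵘ.* mkℚᵘ y n
    ≈⟨ *≡* (trans (neg-* x y (+ suc n)) (cong (λ k → ℤ.- (x ℤ.* y) ℤ.* + suc k) (sym (+-identityʳ n)))) ⟩
  mkℚᵘ (ℤ.- (x ℤ.* y)) n                         ∎)
  where
  open ℚᵘ.≃-Reasoning
  neg-* : ∀ x y d → (ℤ.- x ℤ.* y) ℤ.* d ≡ ℤ.- (x ℤ.* y) ℤ.* d
  neg-* = ℤ-Solver.solve-∀

/-neg : ∀ {i} n → i ℤ.< + 0 → i ℚ./ suc n ℚ.< 0ℚ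
/-neg {i} n i<0 = ℚ.toℚᵘ-cancel-< (ℚᵘ.<-respˡ-≃ (ℚᵘ.≃-sym (toℚᵘ-/ i n)) (*<* i*1<0))
  where i*1<0 = subst (ℤ._< + 0) (sym (ℤ.*-identityʳ i)) i<0

private
  +r≢+s+[1+k]*m : ∀ {r s m} k → r < m → ¬ (+ r ≡ + s ℤ.+ +[1+ k ] ℤ.* + m)
  +r≢+s+[1+k]*m {r} {s} {m} k r<m eq = <-irrefl refl (<-≤-trans r<m (begin
    m             ≤⟨ m≤n*m m (suc k) ⟩
    suc k * m     ≤⟨ m≤n+m _ s ⟩
    s + suc k * m ≡⟨ ℤ.+-injective (trans eq (sym cast)) ⟨
    r             ∎))
    where
    open ≤-Reasoning
    cast : + (s + suc k * m) ≡ + s ℤ.+ +[1+ k ] ℤ.* + m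
    cast = trans (ℤ.pos-+ s _) (cong (ℤ._+_ (+ s)) (ℤ.pos-* (suc k) m))

quotient-unique : ∀ {m r₁ r₂ q₁ q₂} → r₁ < m → r₂ < m →
                  + r₁ ℤ.+ q₁ ℤ.* + m ≡ + r₂ ℤ.+ q₂ ℤ.* + m → q₁ ≡ q₂
quotient-unique {m} {r₁} {r₂} {q₁} {q₂} r₁<m r₂<m eq =
  sym (ℤ.i-j≡0⇒i≡j q₂ q₁ (difference-zero (q₂ ℤ.- q₁) shift))
  where
  cancel : ∀ r q m → r ≡ (r ℤ.+ q ℤ.* m) ℤ.- q ℤ.* m
  cancel = ℤ-Solver.solve-∀
  regroup : ∀ r q₂ q₁ m → (r ℤ.+ q₂ ℤ.* m) ℤ.- q₁ ℤ.* m ≡ r ℤ.+ (q₂ ℤ.- q₁) ℤ.* m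
  regroup = ℤ-Solver.solve-∀
  flip : ∀ r p m → r ≡ (r ℤ.+ (ℤ.- p) ℤ.* m) ℤ.+ p ℤ.* m
  flip = ℤ-Solver.solve-∀
  shift : + r₁ ≡ + r₂ ℤ.+ (q₂ ℤ.- q₁) ℤ.* + m
  shift = trans (cancel (+ r₁) q₁ (+ m)) (trans (cong (ℤ._- q₁ ℤ.* + m) eq) (regroup (+ r₂) q₂ q₁ (+ m)))
  difference-zero : ∀ δ → + r₁ ≡ + r₂ ℤ.+ δ ℤ.* + m → δ ≡ + 0
  difference-zero (+ zero)  _  = refl
  difference-zero +[1+ k ] eq′ = ⊥-elim (+r≢+s+[1+k]*m k r₁<m eq′)
  difference-zero -[1+ k ] eq′ =
    ⊥-elim (+r≢+s+[1+k]*m k r₂<m (trans (flip (+ r₂) +[1+ k ] (+ m)) (cong (ℤ._+ +[1+ k ] ℤ.* + m) (sym eq′))))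

private
  scale : ∀ r q b d → (+ r ℤ.+ q ℤ.* + b) ℤ.* + d ≡ + (r * d) ℤ.+ q ℤ.* + (b * d)
  scale r q b d =
    trans (distrib (+ r) q (+ b) (+ d)) (sym (cong₂ (λ x y → x ℤ.+ q ℤ.* y) (ℤ.pos-* r d) (ℤ.pos-* b d)))
    where distrib : ∀ r q b d → (r ℤ.+ q ℤ.* b) ℤ.* d ≡ r ℤ.* d ℤ.+ q ℤ.* (b ℤ.* d)
          distrib = ℤ-Solver.solve-∀

-- Both floor p and Q are the quotient of ↥ p · d = z · ↧ p by ↧ p · d.
floor-≃ᵘ : ∀ p {z R Q} n → toℚᵘ p ℚᵘ.≃ mkℚᵘ z n → R < suc n → z ≡ + R ℤ.+ Q ℤ.* + suc n →
           floor p ≡ Q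
floor-≃ᵘ (mkℚ a b-1 _) {z} {R} {Q} n (*≡* cross) R<d z≡ = quotient-unique
  (*-monoˡ-< d (n%d<d a (+ b)))
  (subst (R * b <_) (*-comm d b) (*-monoˡ-< b R<d))
  (begin
    + (a ℤ.% + b * d) ℤ.+ a ℤ./ + b ℤ.* + (b * d) ≡⟨ scale (a ℤ.% + b) (a ℤ./ + b) b d ⟨
    (+ (a ℤ.% + b) ℤ.+ a ℤ./ + b ℤ.* + b) ℤ.* + d ≡⟨ cong (ℤ._* + d) (a≡a%n+[a/n]*n a (+ b)) ⟨
    a ℤ.* + d                                     ≡⟨ cross ⟩
    z ℤ.* + b                                     ≡⟨ cong (ℤ._* + b) z≡ ⟩
    (+ R ℤ.+ Q ℤ.* + d) ℤ.* + b                   ≡⟨ scale R Q d b ⟩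
    + (R * b) ℤ.+ Q ℤ.* + (d * b)                 ≡⟨ cong (λ k → + (R * b) ℤ.+ Q ℤ.* + k) (*-comm d b) ⟩
    + (R * b) ℤ.+ Q ℤ.* + (b * d)                 ∎)
  where
  open ≡-Reasoning
  b = suc b-1
  d = suc n

frac-/ : ∀ {z R Q} n → R < suc n → z ≡ + R ℤ.+ Q ℤ.* + suc n → frac (z ℚ./ suc n) ≡ + R ℚ./ suc n
frac-/ {z} {R} {Q} n R<d z≡ =
  trans (cong (λ q → z ℚ./ d ℚ.- q ℚ./ 1) (floor-≃ᵘ (z ℚ./ d) {Q = Q} n (toℚᵘ-/ z n) R<d z≡))
        (≃ᵘ⇒≡/ (+ R) n z/d-Q≃R/d)
  where
  d = suc n
  cancel : ∀ R Q d → ((R ℤ.+ Q ℤ.* d) ℤ.* + 1 ℤ.+ ℤ.- Q ℤ.* d) ℤ.* d ≡ R ℤ.* d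
  cancel = ℤ-Solver.solve-∀
  open ℚᵘ.≃-Reasoning
  z/d-Q≃R/d : toℚᵘ (z ℚ./ d ℚ.- Q ℚ./ 1) ℚᵘ.≃ mkℚᵘ (+ R) n
  z/d-Q≃R/d = begin
    toℚᵘ (z ℚ./ d ℚ.- Q ℚ./ 1)
      ≈⟨ ℚ.toℚᵘ-homo-+ (z ℚ./ d) (ℚ.- (Q ℚ./ 1)) ⟩
    toℚᵘ (z ℚ./ d) ℚᵘ.+ toℚᵘ (ℚ.- (Q ℚ./ 1))
      ≈⟨ ℚᵘ.+-congʳ (toℚᵘ (z ℚ./ d)) (ℚ.toℚᵘ-homo‿- (Q ℚ./ 1)) ⟩
    toℚᵘ (z ℚ./ d) ℚᵘ.- toℚᵘ (Q ℚ./ 1)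
      ≈⟨ ℚᵘ.+-cong (toℚᵘ-/ z n) (ℚᵘ.-‿cong (toℚᵘ-/ Q 0)) ⟩
    mkℚᵘ z n ℚᵘ.- mkℚᵘ Q 0
      ≈⟨ *≡* (trans (cong (λ z → (z ℤ.* + 1 ℤ.+ ℤ.- Q ℤ.* + d) ℤ.* + d) z≡)
                    (trans (cancel (+ R) Q (+ d)) (cong (λ k → + R ℤ.* + suc k) (sym (*-identityʳ n))))) ⟩
    mkℚᵘ (+ R) n
      ∎

module _ (n : ℕ) where
  private d = suc n

  sumℚ-/ : ∀ (F : ℕ → ℚ) (f g : ℕ → ℕ) m → (∀ i → F i ≡ + f i ℚ./ d) →
           sumℚ (map F (applyUpTo g m)) ≡ + ∑[ i < m ] f (g i) ℚ./ d
  sumℚ-/ F f g zero    F≡ = sym (ℚ.0/n≡0 d)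
  sumℚ-/ F f g (suc m) F≡ = begin
    F (g 0) ℚ.+ sumℚ (map F (applyUpTo (g ∘ suc) m))
      ≡⟨ cong₂ ℚ._+_ (F≡ (g 0)) (sumℚ-/ F f (g ∘ suc) m F≡) ⟩
    + f (g 0) ℚ./ d ℚ.+ + rest ℚ./ d                  ≡⟨ /-distrib-+ (+ f (g 0)) (+ rest) n ⟨
    (+ f (g 0) ℤ.+ + rest) ℚ./ d                      ≡⟨ cong (ℚ._/ d) (ℤ.pos-+ (f (g 0)) rest) ⟨
    + ∑[ i < suc m ] f (g i) ℚ./ d                    ∎
    where
    open ≡-Reasoning
    rest = ∑[ i < m ] f (g (suc i))

  E₀≡/ : ∀ h ℓ a' (ρ : ℕ → ℕ) → (∀ k → φ' a' d k ≡ + ρ k ℚ./ d) →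
         E₀ h ℓ a' d ≡
         (+ (ρ h * multichoose ℓ h) ℤ.- + (ℓ * ∑[ i < h ] (multichoose (ℓ ∸ 1) i * ρ (h ∸ i)))) ℚ./ d
  E₀≡/ h ℓ a' ρ φ'≡ = begin
    ℚ.- (+ ℓ ℚ./ 1) ℚ.* sumℚ (map term (upTo h)) ℚ.+ φ' a' d h ℚ.* (+ M ℚ./ 1)
      ≡⟨ cong₂ (λ s p → ℚ.- (+ ℓ ℚ./ 1) ℚ.* s ℚ.+ p ℚ.* (+ M ℚ./ 1))
               (sumℚ-/ term f (λ i → i) h term≡) (φ'≡ h) ⟩
    ℚ.- (+ ℓ ℚ./ 1) ℚ.* (+ A ℚ./ d) ℚ.+ (+ ρ h ℚ./ d) ℚ.* (+ M ℚ./ 1)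
      ≡⟨ cong₂ ℚ._+_ (-/1-*-/ (+ ℓ) (+ A) n) (/-*-/1 (+ ρ h) (+ M) n) ⟩
    (ℤ.- (+ ℓ ℤ.* + A)) ℚ./ d ℚ.+ (+ ρ h ℤ.* + M) ℚ./ d
      ≡⟨ /-distrib-+ (ℤ.- (+ ℓ ℤ.* + A)) (+ ρ h ℤ.* + M) n ⟨
    (ℤ.- (+ ℓ ℤ.* + A) ℤ.+ + ρ h ℤ.* + M) ℚ./ d
      ≡⟨ cong (ℚ._/ d) (trans (reorder (+ ℓ) (+ A) (+ ρ h) (+ M))
                              (cong₂ ℤ._-_ (sym (ℤ.pos-* (ρ h) M)) (sym (ℤ.pos-* ℓ A)))) ⟩
    (+ (ρ h * M) ℤ.- + (ℓ * A)) ℚ./ d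
      ∎
    where
    open ≡-Reasoning
    M = multichoose ℓ h
    c = multichoose (ℓ ∸ 1)
    f : ℕ → ℕ
    f i = c i * ρ (h ∸ i)
    A = ∑[ i < h ] f i
    term : ℕ → ℚ
    term i = φ' a' d (h ∸ i) ℚ.* (+ c i ℚ./ 1)
    term≡ : ∀ i → term i ≡ + f i ℚ./ d
    term≡ i = begin
      φ' a' d (h ∸ i) ℚ.* (+ c i ℚ./ 1)     ≡⟨ cong (ℚ._* (+ c i ℚ./ 1)) (φ'≡ (h ∸ i)) ⟩
      (+ ρ (h ∸ i) ℚ./ d) ℚ.* (+ c i ℚ./ 1) ≡⟨ /-*-/1 (+ ρ (h ∸ i)) (+ c i) n ⟩
      (+ ρ (h ∸ i) ℤ.* + c i) ℚ./ d
        ≡⟨ cong (ℚ._/ d) (trans (sym (ℤ.pos-* (ρ (h ∸ i)) (c i))) (cong +_ (*-comm (ρ (h ∸ i)) (c i)))) ⟩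
      + f i ℚ./ d                           ∎
    reorder : ∀ l a r m → ℤ.- (l ℤ.* a) ℤ.+ r ℤ.* m ≡ r ℤ.* m ℤ.- l ℤ.* a
    reorder = ℤ-Solver.solve-∀

module Residues (a' : ℤ) (n : ℕ) where
  private
    d = suc n
    α = a' ℤ.% + d
    q = a' ℤ./ + d
    quotient : ℕ → ℤ
    quotient k = + (k * α / d) ℤ.+ + k ℤ.* q

  ρ : ℕ → ℕ
  ρ k = k * α % d

  ρ<d : ∀ k → ρ k < d
  ρ<d k = m%n<n (k * α) d

  ρ-subadditive : ∀ i j → ρ (i + j) ≤ ρ i + ρ j
  ρ-subadditive i j = subst (_≤ ρ i + ρ j) ρᵢ₊ⱼ≡ (m%n≤m (ρ i + ρ j) d)
    where ρᵢ₊ⱼ≡ : (ρ i + ρ j) % d ≡ ρ (i + j)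
          ρᵢ₊ⱼ≡ = sym (trans (cong (_% d) (*-distribʳ-+ α i j)) (%-distribˡ-+ (i * α) (j * α) d))

  ρ-decomposition : ∀ k → + k ℤ.* a' ≡ + ρ k ℤ.+ quotient k ℤ.* + d
  ρ-decomposition k = begin
    + k ℤ.* a'                                     ≡⟨ cong (+ k ℤ.*_) (a≡a%n+[a/n]*n a' (+ d)) ⟩
    + k ℤ.* (+ α ℤ.+ q ℤ.* + d)                    ≡⟨ expand (+ k) (+ α) q (+ d) ⟩
    + k ℤ.* + α ℤ.+ kq ℤ.* + d                     ≡⟨ cong (ℤ._+ kq ℤ.* + d) (ℤ.pos-* k α) ⟨
    + (k * α) ℤ.+ kq ℤ.* + d                       ≡⟨ cong (λ x → + x ℤ.+ kq ℤ.* + d) (m≡m%n+[m/n]*n (k * α) d) ⟩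
    + (ρ k + k * α / d * d) ℤ.+ kq ℤ.* + d         ≡⟨ cong (ℤ._+ kq ℤ.* + d) cast ⟩
    + ρ k ℤ.+ + (k * α / d) ℤ.* + d ℤ.+ kq ℤ.* + d ≡⟨ collect (+ ρ k) (+ (k * α / d)) kq (+ d) ⟩
    + ρ k ℤ.+ quotient k ℤ.* + d                   ∎
    where
    open ≡-Reasoning
    kq = + k ℤ.* q
    cast : + (ρ k + k * α / d * d) ≡ + ρ k ℤ.+ + (k * α / d) ℤ.* + d
    cast = trans (ℤ.pos-+ (ρ k) _) (cong (ℤ._+_ (+ ρ k)) (ℤ.pos-* (k * α / d) d))
    expand : ∀ k a q d → k ℤ.* (a ℤ.+ q ℤ.* d) ≡ k ℤ.* a ℤ.+ (k ℤ.* q) ℤ.* d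
    expand = ℤ-Solver.solve-∀
    collect : ∀ r m p d → r ℤ.+ m ℤ.* d ℤ.+ p ℤ.* d ≡ r ℤ.+ (m ℤ.+ p) ℤ.* d
    collect = ℤ-Solver.solve-∀

  φ'≡ρ/ : ∀ k → φ' a' d k ≡ + ρ k ℚ./ d
  φ'≡ρ/ k = frac-/ {Q = quotient k} n (ρ<d k) (ρ-decomposition k)

  ρ₁-pos : Coprime ∣ a' ∣ d → d ≢ 1 → 0 < ρ 1
  ρ₁-pos coprime d≢1 = subst (0 <_) (sym ρ₁≡α) (n≢0⇒n>0 α≢0)
    where
    ρ₁≡α : ρ 1 ≡ α
    ρ₁≡α = trans (cong (_% d) (*-identityˡ α)) (m<n⇒m%n≡m (n%d<d a' (+ d)))
    a'≡qd : α ≡ 0 → a' ≡ q ℤ.* + d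
    a'≡qd α≡0 =
      trans (a≡a%n+[a/n]*n a' (+ d)) (trans (cong (λ r → + r ℤ.+ q ℤ.* + d) α≡0) (ℤ.+-identityˡ _))
    α≢0 : α ≢ 0
    α≢0 α≡0 = d≢1 (coprime (d∣a' , ∣-refl))
      where d∣a' = divides ∣ q ∣ (trans (cong ∣_∣ (a'≡qd α≡0)) (ℤ.abs-* q (+ d)))

lemma3p2 : (h ℓ : ℕ) (a : ℤ) (b : ℕ) (a' : ℤ) (b' : ℕ) →
    2 ≤ h → 3 ≤ ℓ → HFarey h a b → IsPredecessor h a b a' b' →
    b' ≢ 1 → E₀ h ℓ a' b' ℚ.< 0ℚ
lemma3p2 h ℓ@(suc (suc (suc L))) a b a' (suc n) _ (s≤s (s≤s (s≤s _))) _ ((_ , b'≤h , coprime) , _) b'≢1 =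
  subst (ℚ._< 0ℚ) (sym (E₀≡/ n h ℓ a' ρ φ'≡ρ/)) (/-neg n numerator<0)
  where
  open Residues a' n
  X = ρ h * multichoose ℓ h
  Y = ℓ * ∑[ i < h ] (multichoose (ℓ ∸ 1) i * ρ (h ∸ i))
  ρₕ<hρ₁ : ρ h < h * ρ 1
  ρₕ<hρ₁ = <-≤-trans (ρ<d h) (≤-trans b'≤h (m≤m*n h (ρ 1) {{>-nonZero (ρ₁-pos coprime b'≢1)}}))
  X<Y : X < Y
  X<Y = subadditive-multichoose-< ρ refl ρ-subadditive L h ρₕ<hρ₁
  numerator<0 : + X ℤ.- + Y ℤ.< + 0
  numerator<0 = subst (+ X ℤ.- + Y ℤ.<_) (ℤ.+-inverseʳ (+ Y)) (ℤ.+-monoˡ-< (ℤ.- + Y) (ℤ.+<+ X<Y))
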